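{- Let $C$ be a cycle of a (possibly infinite) graph $G$, let $F\subseteq E(C)$ with $|F|\ge 2$, and let $(T,(B_t:t\in V(T)))$ be a tree-decomposition of $G$. Then there exist $t\in V(T)$ and $u,v\in V(C)\cap B_t$ such that $d_{C,F}(u,v)\ge |F|/3$.
   Context: A tree-decomposition of $G$ is a pair $(T,(B_t:t\in V(T)))$ where $T$ is a (possibly infinite) tree and $B_t\subseteq V(G)$, such that $V(G)=\bigcup_t B_t$; every edge has both ends in some $B_t$; and if $t_2$ lies on the $T$-path between $t_1,t_3$ then $B_{t_1}\cap B_{t_3}\subseteq B_{t_2}$. For a cycle $C$, $F\subseteq E(C)$ and distinct $u,v\in V(C)$, $d_{C,F}(u,v)$ is the smaller of $|E(P)\cap F|$ and $|E(Q)\cap F|$, where $P,Q$ are the two paths of $C$ between $u$ and $v$; and $d_{C,F}(u,u)=0$. -}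

module Defs where

open import Data.Nat using (ℕ; zero; suc; _+_; _*_; _∸_; _≤_; _<_; _<?_; _⊓_)
open import Data.Nat.DivMod using (_%_; m%n<n)
open import Data.Fin using (Fin; toℕ; fromℕ<)
open import Data.Fin.Subset using (Subset; inside; outside; _∩_; ∣_∣; _∈_)
open import Data.Vec using (tabulate)
open import Data.List using (List; []; _∷_)
open import Data.List.Relation.Unary.Unique.Propositional using (Unique)
import Data.List.Membership.Propositional as LM
open import Data.Product using (Σ; ∃; _×_; _,_)
open import Relation.Binary.PropositionalEquality using (_≡_)
open import Relation.Nullary using (¬_)
open import Relation.Nullary.Decidable using (⌊_⌋)
open import Function.Definitions using (Injective)
open import Data.Unit using (⊤)
open import Data.Bool using (if_then_else_)
open import Data.Empty using (⊥)

record Graph : Set₁ where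
  field
    V      : Set
    Adj    : V → V → Set
    sym    : ∀ {x y} → Adj x y → Adj y x
    irrefl : ∀ {x} → ¬ Adj x x

module _ (G : Graph) where
  open Graph G

  Walk : List V → Set
  Walk []           = ⊤
  Walk (x ∷ [])     = ⊤
  Walk (x ∷ y ∷ xs) = Adj x y × Walk (y ∷ xs)

  StartsAt : V → List V → Set
  StartsAt s []      = ⊥
  StartsAt s (x ∷ _) = x ≡ s

  EndsAt : V → List V → Set
  EndsAt t []           = ⊥
  EndsAt t (x ∷ [])     = x ≡ t
  EndsAt t (x ∷ y ∷ xs) = EndsAt t (y ∷ xs)

  IsPath : V → V → List V → Set
  IsPath s t P = StartsAt s P × EndsAt t P × Walk P × Unique P

  IsTree : Set
  IsTree = (∀ s t → ∃ λ P → IsPath s t P)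
         × (∀ s t P Q → IsPath s t P → IsPath s t Q → P ≡ Q)

  OnPath : V → V → V → Set
  OnPath s r t = ∀ P → IsPath s t P → r LM.∈ P

record TreeDecomposition (G : Graph) : Set₁ where
  field
    T      : Graph
    isTree : IsTree T
    B      : Graph.V T → Graph.V G → Set   -- B t x  means  x ∈ B_t
    cover  : ∀ x → ∃ λ t → B t x
    edge   : ∀ x y → Graph.Adj G x y → ∃ λ t → B t x × B t y
    coh    : ∀ t₁ t₂ t₃ → OnPath T t₁ t₂ t₃ →
             ∀ x → B t₁ x → B t₃ x → B t₂ x

-- Cycles.  A cycle of length n (n ≥ 3) is an injective map
-- c : Fin n → V with c i adjacent to c (i+1 mod n).  Edge i of the
-- cycle is the edge c i — c (i+1 mod n); so E(C) is indexed by Fin n.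

csuc : ∀ {n} → Fin n → Fin n
csuc {suc n} i = fromℕ< (m%n<n (suc (toℕ i)) (suc n))

record Cycle (G : Graph) : Set where
  field
    len   : ℕ
    len≥3 : 3 ≤ len
    vtx   : Fin len → Graph.V G
    inj   : Injective _≡_ _≡_ vtx
    adj   : ∀ i → Graph.Adj G (vtx i) (vtx (csuc i))

-- forward arc from i to j: the edges i, i+1, ..., j-1 (mod n), i.e. the
-- edge set of one of the two paths of C between vertices i and j
-- (empty when i = j)
offset : ∀ {n} → Fin n → Fin n → ℕ
offset {suc n} i k = (toℕ k + suc n ∸ toℕ i) % suc n

arc : ∀ {n} → Fin n → Fin n → Subset n
arc i j = tabulate (λ k → if ⌊ offset i k <? offset i j ⌋ then inside else outside)

-- d_{C,F}(u,v) for u = vtx i, v = vtx j: the smaller number of F-edges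
-- on the two paths of C between them (0 when i = j)
dist : ∀ {n} → Subset n → Fin n → Fin n → ℕ
dist F i j = ∣ F ∩ arc i j ∣ ⊓ ∣ F ∩ arc j i ∣

module Submission where

open import Defs
open import Algebra.Properties.CommutativeSemigroup as CommSemigroup using ()
open import Data.Bool using (Bool; true; false; not; _∧_; _∨_; if_then_else_)
open import Data.Bool.Properties using (∨-inverseʳ; ∧-inverseʳ; ∧-zeroʳ)
open import Data.Fin using (Fin; toℕ) renaming (zero to fzero; suc to fsuc)
open import Data.Fin.Properties using (toℕ<n; suc-injective; toℕ-injective; toℕ-fromℕ<)
open import Data.Fin.Subset using (Subset; inside; outside; _∩_; ∣_∣)
open import Data.Fin.Subset.Properties using (∩-identityʳ; ∩-zeroʳ; ∣⊥∣≡0; ∣p∩q∣≤∣p∣)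
open import Data.List using (List; []; _∷_; _++_; _∷ʳ_; reverse)
open import Data.List.Properties using (++-identityʳ; unfold-reverse)
open import Data.List.Membership.Propositional using (_∈_; _∉_; lose)
open import Data.List.Membership.Propositional.Properties using (∈-++⁺ˡ; ∈-++⁺ʳ; ∈-++⁻; ∈-∃++)
open import Data.List.Relation.Binary.Disjoint.Propositional using (Disjoint)
open import Data.List.Relation.Binary.Permutation.Propositional using (↭-sym; ↭⇒↭ₛ)
open import Data.List.Relation.Binary.Permutation.Propositional.Properties using (↭-reverse)
import Data.List.Relation.Binary.Permutation.Setoid.Properties as Permutation
open import Data.List.Relation.Unary.All as All using (All; []; _∷_)
import Data.List.Relation.Unary.All.Properties as All
open import Data.List.Relation.Unary.AllPairs using ([]; _∷_)
open import Data.List.Relation.Unary.Any using (Any; here; there)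
open import Data.List.Relation.Unary.Any.Properties using (reverse⁺)
open import Data.List.Relation.Unary.First using () renaming (_++_∷_ to split-at)
open import Data.List.Relation.Unary.First.Properties using (toView; ¬All⇒First)
open import Data.List.Relation.Unary.Unique.Propositional using (Unique)
import Data.List.Relation.Unary.Unique.Propositional.Properties as Unique
open import Data.Nat using (ℕ; zero; suc; _+_; _*_; _∸_; _⊓_; _≤_; _<_; _≤?_; _<?_; z≤n; s≤s;
                            _≤′_; ≤′-refl; ≤′-step)
open import Data.Nat.DivMod using (_/_; _%_; m/n*n≤m; m≡m%n+[m/n]*n; m%n<n; [m+n]%n≡m%n;
                                   m<n⇒m%n≡m; n%n≡0)
open import Data.Nat.Properties hiding (suc-injective; _≟_)
open import Data.Product using (Σ; ∃; ∃₂; _×_; _,_; proj₁; proj₂)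
open import Data.Sum using (_⊎_; inj₁; inj₂)
open import Data.Unit using (tt)
open import Data.Vec using ([]; _∷_; tabulate)
open import Data.Vec.Properties using (tabulate-cong; tabulate-allFin; map-const)
open import Function using (_∘_; _⇔_; mk⇔; case_of_; Equivalence)
open import Relation.Binary.Definitions using (DecidableEquality)
open import Relation.Binary.PropositionalEquality
  using (_≡_; _≗_; refl; sym; trans; cong; cong₂; subst; setoid; module ≡-Reasoning)
open import Relation.Nullary using (Dec; ¬_; ¬?; yes; no; contradiction; decidable-stable)
open import Relation.Nullary.Decidable using (⌊_⌋; _×-dec_; does-⇔; isYes≗does; dec-true)

open CommSemigroup +-commutativeSemigroup using (x∙yz≈yx∙z; xy∙z≈y∙xz)

-- Number the edges of C from 0 to n-1 and let P(m) be the number of F-edges among the first m.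
-- If |F| ≤ 3, any bag containing the ends of an F-edge will do.  Otherwise pick e with
-- 3e < |F| ≤ 3(e+1), and let p and s be the edges at which P passes e and 2e.  The edges p, s
-- and n-1 cut C into three arcs, each connected in G, so the median in T of the bags of these
-- three edges contains a vertex of every arc: say x, y and z.  The arcs of C between x, y and z
-- carry a, b and c edges of F, where a + b + c = |F| and any two of a, b, c add up to more than e.
-- By pigeonhole one of them alone exceeds e, and then both arcs of C between its two ends carry
-- at least e + 1 ≥ |F|/3 edges of F.

module Paths (G : Graph) where
  open Graph G using (V; Adj) renaming (sym to Adj-sym)

  startsAt-∈ : ∀ {s} xs → StartsAt G s xs → s ∈ xs
  startsAt-∈ (x ∷ xs) refl = here refl

  endsAt-∈ : ∀ {t} xs → EndsAt G t xs → t ∈ xs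
  endsAt-∈ (x ∷ [])     refl = here refl
  endsAt-∈ (x ∷ y ∷ xs) e    = there (endsAt-∈ (y ∷ xs) e)

  startsAt-++ : ∀ {s} xs {ys} → StartsAt G s xs → StartsAt G s (xs ++ ys)
  startsAt-++ (x ∷ xs) s = s

  endsAt-∷ʳ : ∀ xs {t} → EndsAt G t (xs ∷ʳ t)
  endsAt-∷ʳ []           = refl
  endsAt-∷ʳ (x ∷ [])     = refl
  endsAt-∷ʳ (x ∷ y ∷ xs) = endsAt-∷ʳ (y ∷ xs)

  endsAt-++⁺ : ∀ xs {t y ys} → EndsAt G t (y ∷ ys) → EndsAt G t (xs ++ y ∷ ys)
  endsAt-++⁺ []            e = e
  endsAt-++⁺ (x ∷ [])      e = e
  endsAt-++⁺ (x ∷ x′ ∷ xs) e = endsAt-++⁺ (x′ ∷ xs) e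

  endsAt-++⁻ : ∀ xs {t y ys} → EndsAt G t (xs ++ y ∷ ys) → EndsAt G t (y ∷ ys)
  endsAt-++⁻ []            e = e
  endsAt-++⁻ (x ∷ [])      e = e
  endsAt-++⁻ (x ∷ x′ ∷ xs) e = endsAt-++⁻ (x′ ∷ xs) e

  startsAt-reverse : ∀ {t} xs → EndsAt G t xs → StartsAt G t (reverse xs)
  startsAt-reverse     (x ∷ [])     e = e
  startsAt-reverse {t} (x ∷ y ∷ xs) e =
    subst (StartsAt G t) (sym (unfold-reverse x (y ∷ xs)))
      (startsAt-++ (reverse (y ∷ xs)) (startsAt-reverse (y ∷ xs) e))

  endsAt-reverse : ∀ {s} xs → StartsAt G s xs → EndsAt G s (reverse xs)
  endsAt-reverse {s} (x ∷ xs) refl =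
    subst (EndsAt G s) (sym (unfold-reverse x xs)) (endsAt-∷ʳ (reverse xs))

  walk-join : ∀ xs {m ys} → Walk G xs → EndsAt G m xs → Walk G (m ∷ ys) → Walk G (xs ++ ys)
  walk-join (x ∷ [])     _        refl w = w
  walk-join (x ∷ y ∷ xs) (a , w₁) e    w = a , walk-join (y ∷ xs) w₁ e w

  walk-++⁻ˡ : ∀ xs {m ys} → Walk G (xs ++ m ∷ ys) → Walk G (xs ∷ʳ m)
  walk-++⁻ˡ []           _       = tt
  walk-++⁻ˡ (x ∷ [])     (a , _) = a , tt
  walk-++⁻ˡ (x ∷ y ∷ xs) (a , w) = a , walk-++⁻ˡ (y ∷ xs) w

  walk-++⁻ʳ : ∀ xs {ys} → Walk G (xs ++ ys) → Walk G ys
  walk-++⁻ʳ []           w       = w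
  walk-++⁻ʳ (x ∷ [])     {[]}    _       = tt
  walk-++⁻ʳ (x ∷ [])     {_ ∷ _} (_ , w) = w
  walk-++⁻ʳ (x ∷ y ∷ xs) (_ , w) = walk-++⁻ʳ (y ∷ xs) w

  walk-reverse : ∀ xs → Walk G xs → Walk G (reverse xs)
  walk-reverse []           _       = tt
  walk-reverse (x ∷ [])     _       = tt
  walk-reverse (x ∷ y ∷ xs) (a , w) =
    subst (Walk G) (sym (unfold-reverse x (y ∷ xs)))
      (walk-join (reverse (y ∷ xs)) (walk-reverse (y ∷ xs) w) (endsAt-reverse (y ∷ xs) refl)
                 (Adj-sym a , tt))

  unique-++⁻ˡ : ∀ (xs : List V) {m ys} → Unique (xs ++ m ∷ ys) → Unique (xs ∷ʳ m)
  unique-++⁻ˡ []       (_ ∷ _)  = [] ∷ []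
  unique-++⁻ˡ (x ∷ xs) (x∉ ∷ u) =
    All.++⁺ (All.++⁻ˡ xs x∉) (All.head (All.++⁻ʳ xs x∉) ∷ []) ∷ unique-++⁻ˡ xs u

  unique-++⁻ʳ : ∀ (xs : List V) {ys} → Unique (xs ++ ys) → Unique ys
  unique-++⁻ʳ []       u       = u
  unique-++⁻ʳ (x ∷ xs) (_ ∷ u) = unique-++⁻ʳ xs u

  unique-reverse : ∀ (xs : List V) → Unique xs → Unique (reverse xs)
  unique-reverse xs = Permutation.Unique-resp-↭ (setoid V) (↭⇒↭ₛ (↭-sym (↭-reverse xs)))

  path-++⁻ˡ : ∀ {s t} xs {m ys} → IsPath G s t (xs ++ m ∷ ys) → IsPath G s m (xs ∷ʳ m)
  path-++⁻ˡ []       (s , _ , _ , _) = s , refl , tt , [] ∷ []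
  path-++⁻ˡ (x ∷ xs) (s , _ , w , u) =
    s , endsAt-∷ʳ (x ∷ xs) , walk-++⁻ˡ (x ∷ xs) w , unique-++⁻ˡ (x ∷ xs) u

  path-++⁻ʳ : ∀ {s t} xs {m ys} → IsPath G s t (xs ++ m ∷ ys) → IsPath G m t (m ∷ ys)
  path-++⁻ʳ xs (_ , e , w , u) = refl , endsAt-++⁻ xs e , walk-++⁻ʳ xs w , unique-++⁻ʳ xs u

  path-join : ∀ {s m t} xs ys → IsPath G s m xs → IsPath G m t (m ∷ ys) → Disjoint xs ys →
              IsPath G s t (xs ++ ys)
  path-join xs []       p               (_ , refl , _)       _ =
    subst (IsPath G _ _) (sym (++-identityʳ xs)) p
  path-join xs (y ∷ ys) (s , e , w , u) (_ , e′ , w′ , u′) d =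
    startsAt-++ xs s , endsAt-++⁺ xs e′ , walk-join xs w e w′ ,
    Unique.++⁺ u (unique-++⁻ʳ (_ ∷ []) u′) d

  path-reverse : ∀ {s t} xs → IsPath G s t xs → IsPath G t s (reverse xs)
  path-reverse xs (s , e , w , u) =
    startsAt-reverse xs e , endsAt-reverse xs s , walk-reverse xs w , unique-reverse xs u

module TreePaths (T : Graph) (tree : IsTree T) where
  open Graph T using (V)
  open Paths T

  path : V → V → List V
  path a b = proj₁ (proj₁ tree a b)

  path-isPath : ∀ a b → IsPath T a b (path a b)
  path-isPath a b = proj₂ (proj₁ tree a b)

  path-unique : ∀ {a b xs} → IsPath T a b xs → xs ≡ path a b
  path-unique {a} {b} {xs} p = proj₂ tree a b xs (path a b) p (path-isPath a b)

  _≟_ : DecidableEquality V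
  a ≟ b with path a b | path-isPath a b
  ... | x ∷ []     | refl , refl , _       = yes refl
  ... | x ∷ y ∷ xs | refl , e , _ , x∉ ∷ _ =
    no λ { refl → All.lookup x∉ (endsAt-∈ (y ∷ xs) e) refl }

  open import Data.List.Membership.DecPropositional _≟_ using (_∈?_)

  split-at-first-∈ : ∀ (A xs : List V) → Any (_∈ A) xs →
                     ∃₂ λ pre m → ∃ λ suf → xs ≡ pre ++ m ∷ suf × All (_∉ A) pre × m ∈ A
  split-at-first-∈ A xs hit
    with toView (¬All⇒First (λ v → ¬? (v ∈? A)) (decidable-stable (_ ∈? A))
                            (λ all → All.All¬⇒¬Any all hit))
  ... | split-at pre∉ m∈ suf = _ , _ , suf , refl , pre∉ , m∈

  onPath-intro : ∀ {a b r xs} → IsPath T a b xs → r ∈ xs → OnPath T a r b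
  onPath-intro p r∈ ys q = subst (_ ∈_) (trans (path-unique p) (sym (path-unique q))) r∈

  onPath-elim : ∀ {a b r} → OnPath T a r b → r ∈ path a b
  onPath-elim {a} {b} o = o (path a b) (path-isPath a b)

  onPath-sym : ∀ {a b r} → OnPath T a r b → OnPath T b r a
  onPath-sym {a} {b} o = onPath-intro (path-reverse (path a b) (path-isPath a b)) (reverse⁺ (onPath-elim o))

  path-split : ∀ {a b m} → OnPath T a m b →
               ∃₂ λ xs ys → path a b ≡ xs ++ m ∷ ys ×
                            IsPath T a m (xs ∷ʳ m) × IsPath T m b (m ∷ ys)
  path-split {a} {b} o with ∈-∃++ (onPath-elim o)
  ... | xs , ys , eq = xs , ys , eq , path-++⁻ˡ xs p , path-++⁻ʳ xs p
    where p = subst (IsPath T a b) eq (path-isPath a b)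

  onPath-through : ∀ {a b m r} → OnPath T a m b → OnPath T a r b → OnPath T a r m ⊎ OnPath T m r b
  onPath-through amb arb with path-split amb
  ... | xs , ys , eq , am , mb with ∈-++⁻ xs (subst (_ ∈_) eq (onPath-elim arb))
  ...   | inj₁ r∈xs = inj₁ (onPath-intro am (∈-++⁺ˡ r∈xs))
  ...   | inj₂ r∈ys = inj₂ (onPath-intro mb r∈ys)

  onPath-prefix : ∀ {a b m r} → OnPath T a m b → OnPath T a r m → OnPath T a r b
  onPath-prefix {a} {b} amb arm with path-split amb
  ... | xs , ys , eq , am , _ = onPath-intro (path-isPath a b) (subst (_ ∈_) (sym eq) (extend (arm _ am)))
    where
    extend : ∀ {r} → r ∈ xs ∷ʳ _ → r ∈ xs ++ _ ∷ ys
    extend r∈ with ∈-++⁻ xs r∈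
    ... | inj₁ r∈xs       = ∈-++⁺ˡ r∈xs
    ... | inj₂ (here r≡m) = ∈-++⁺ʳ xs (here r≡m)

  onPath-suffix : ∀ {a b m r} → OnPath T a m b → OnPath T m r b → OnPath T a r b
  onPath-suffix {a} {b} amb mrb with path-split amb
  ... | xs , ys , eq , _ , mb =
    onPath-intro (path-isPath a b) (subst (_ ∈_) (sym eq) (∈-++⁺ʳ xs (mrb _ mb)))

  -- m is the first vertex of the c–a path that lies on the a–b path; the c–m segment of the one
  -- and the m–b segment of the other are then disjoint and make up the c–b path.
  median : ∀ a b c → ∃ λ m → OnPath T a m b × OnPath T b m c × OnPath T c m a
  median a b c
    with split-at-first-∈ (path a b) (path c a)
           (lose (endsAt-∈ _ (proj₁ (proj₂ (path-isPath c a))))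
                 (startsAt-∈ _ (proj₁ (path-isPath a b))))
  ... | pre , m , suf , eq , pre∉ , m∈ =
    m , amb , onPath-sym cmb , onPath-intro ca (∈-++⁺ʳ pre (here refl))
    where
    ca = subst (IsPath T c a) eq (path-isPath c a)
    amb = onPath-intro (path-isPath a b) m∈
    cmb : OnPath T c m b
    cmb with path-split amb
    ... | xs , ys , eq′ , _ , mb@(_ , _ , _ , m∉ys ∷ _) =
      onPath-intro (path-join (pre ∷ʳ m) ys (path-++⁻ˡ pre ca) mb disjoint)
                   (∈-++⁺ˡ (∈-++⁺ʳ pre (here refl)))
      where
      disjoint : Disjoint (pre ∷ʳ m) ys
      disjoint (v∈ , v∈ys) with ∈-++⁻ pre v∈
      ... | inj₁ v∈pre       =
        All.lookup pre∉ v∈pre (subst (_ ∈_) (sym eq′) (∈-++⁺ʳ xs (there v∈ys)))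
      ... | inj₂ (here refl) = All.lookup m∉ys v∈ys refl

  onPath-split : ∀ {a c r} b → OnPath T a r c → OnPath T a r b ⊎ OnPath T b r c
  onPath-split {a} {c} b arc with median a b c
  ... | m , amb , bmc , cma with onPath-through (onPath-sym cma) arc
  ...   | inj₁ arm = inj₁ (onPath-prefix amb arm)
  ...   | inj₂ mrc = inj₂ (onPath-suffix bmc mrc)

module _ {G : Graph} (D : TreeDecomposition G) where
  open TreeDecomposition D
  open TreePaths T isTree using (onPath-split)

  walk-meets-path-bags : (w : ℕ → Graph.V G) → (∀ k → Graph.Adj G (w k) (w (suc k))) →
                         ∀ {lo hi a b r} → lo ≤′ hi → B a (w lo) → B b (w hi) → OnPath T a r b →
                         ∃ λ k → lo ≤ k × k ≤ hi × B r (w k)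
  walk-meets-path-bags w step {lo} {a = a} {b} {r} ≤′-refl Ba Bb arb =
    lo , ≤-refl , ≤-refl , coh a r b arb _ Ba Bb
  walk-meets-path-bags w step {hi = suc h} {a} {b} {r} (≤′-step lo≤h) Ba Bb arb
    with edge (w h) (w (suc h)) (step h)
  ... | s , Bs₁ , Bs₂ with onPath-split s arb
  ...   | inj₂ srb = suc h , ≤′⇒≤ (≤′-step lo≤h) , ≤-refl , coh s r b srb _ Bs₂ Bb
  ...   | inj₁ ars with walk-meets-path-bags w step lo≤h Ba Bs₁ ars
  ...     | k , lo≤k , k≤h , Brk = k , lo≤k , m≤n⇒m≤1+n k≤h , Brk

⌊⌋-⇔ : ∀ {A B : Set} → A ⇔ B → (a? : Dec A) (b? : Dec B) → ⌊ a? ⌋ ≡ ⌊ b? ⌋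
⌊⌋-⇔ A⇔B a? b? = trans (isYes≗does a?) (trans (does-⇔ A⇔B a? b?) (sym (isYes≗does b?)))

⌊¬?⌋ : ∀ {A : Set} (a? : Dec A) → ⌊ ¬? a? ⌋ ≡ not ⌊ a? ⌋
⌊¬?⌋ (yes _) = refl
⌊¬?⌋ (no _)  = refl

-- Index sets are cut out of Fin n by Boolean predicates, in the same way as arc in Defs,
-- so that dist unfolds to two counts.
count : ∀ {n} → Subset n → (Fin n → Bool) → ℕ
count F p = ∣ F ∩ tabulate (λ k → if p k then inside else outside) ∣

module _ {n} (F : Subset n) where

  count-cong : ∀ {p q} → p ≗ q → count F p ≡ count F q
  count-cong p≗q =
    cong (λ S → ∣ F ∩ S ∣) (tabulate-cong (cong (λ b → if b then inside else outside) ∘ p≗q))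

  count-true : count F (λ _ → true) ≡ ∣ F ∣
  count-true = trans (cong (λ S → ∣ F ∩ S ∣) (trans (tabulate-allFin _) (map-const _ inside)))
                     (cong ∣_∣ (∩-identityʳ F))

  count-false : count F (λ _ → false) ≡ 0
  count-false = trans (cong (λ S → ∣ F ∩ S ∣) (trans (tabulate-allFin _) (map-const _ outside)))
                      (trans (cong ∣_∣ (∩-zeroʳ F)) (∣⊥∣≡0 n))

  count≤∣F∣ : ∀ p → count F p ≤ ∣ F ∣
  count≤∣F∣ p = ∣p∩q∣≤∣p∣ F _

count-∨ : ∀ {n} (F : Subset n) p q → (∀ k → p k ∧ q k ≡ false) →
          count F (λ k → p k ∨ q k) ≡ count F p + count F q
count-∨ []          p q disjoint = refl
count-∨ (false ∷ F) p q disjoint = count-∨ F (p ∘ fsuc) (q ∘ fsuc) (disjoint ∘ fsuc)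
count-∨ (true ∷ F)  p q disjoint
  with p fzero | q fzero | disjoint fzero | count-∨ F (p ∘ fsuc) (q ∘ fsuc) (disjoint ∘ fsuc)
... | true  | true  | () | _
... | true  | false | _  | ih = cong suc ih
... | false | true  | _  | ih = trans (cong suc ih) (sym (+-suc _ _))
... | false | false | _  | ih = ih

count-≤1 : ∀ {n} (F : Subset n) p → (∀ k l → p k ≡ true → p l ≡ true → k ≡ l) → count F p ≤ 1
count-≤1 []          p unique = z≤n
count-≤1 (false ∷ F) p unique = count-≤1 F (p ∘ fsuc) (λ _ _ pk pl → suc-injective (unique _ _ pk pl))
count-≤1 (true ∷ F)  p unique with p fzero in p0
... | false = count-≤1 F (p ∘ fsuc) (λ _ _ pk pl → suc-injective (unique _ _ pk pl))
... | true  = s≤s (≤-reflexive (trans (count-cong F rest-false) (count-false F)))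
  where
  rest-false : ∀ k → p (fsuc k) ≡ false
  rest-false k with p (fsuc k) in pk
  ... | true  = case unique fzero (fsuc k) p0 pk of λ ()
  ... | false = refl

below : ∀ {n} → ℕ → Fin n → Bool
below y k = ⌊ toℕ k <? y ⌋

between : ∀ {n} → ℕ → ℕ → Fin n → Bool
between x y k = ⌊ (x ≤? toℕ k) ×-dec (toℕ k <? y) ⌋

module _ {n} (F : Subset n) where

  count-not : ∀ p → count F p + count F (not ∘ p) ≡ ∣ F ∣
  count-not p = begin
    count F p + count F (not ∘ p)     ≡⟨ count-∨ F p (not ∘ p) (∧-inverseʳ ∘ p) ⟨
    count F (λ k → p k ∨ not (p k))   ≡⟨ count-cong F (∨-inverseʳ ∘ p) ⟩
    count F (λ _ → true)              ≡⟨ count-true F ⟩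
    ∣ F ∣                             ∎
    where open ≡-Reasoning

  count-not-≡ : ∀ p {s} → count F p + s ≡ ∣ F ∣ → count F (not ∘ p) ≡ s
  count-not-≡ p eq = +-cancelˡ-≡ (count F p) _ _ (trans (count-not p) (sym eq))

  count-below-split : ∀ {x y} → x ≤ y → count F (between x y) + count F (below x) ≡ count F (below y)
  count-below-split {x} {y} x≤y =
    trans (sym (count-∨ F (between x y) (below x) (disjoint ∘ toℕ))) (count-cong F (sym ∘ split ∘ toℕ))
    where
    disjoint : ∀ a → ⌊ (x ≤? a) ×-dec (a <? y) ⌋ ∧ ⌊ a <? x ⌋ ≡ false
    disjoint a with x ≤? a | a <? x
    ... | yes x≤a | yes a<x = contradiction x≤a (<⇒≱ a<x)
    ... | yes _   | no _    = ∧-zeroʳ _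
    ... | no _    | _       = refl
    split : ∀ a → ⌊ a <? y ⌋ ≡ ⌊ (x ≤? a) ×-dec (a <? y) ⌋ ∨ ⌊ a <? x ⌋
    split a with x ≤? a | a <? y | a <? x
    ... | yes _   | yes _   | _       = refl
    ... | yes x≤a | no _    | yes a<x = contradiction x≤a (<⇒≱ a<x)
    ... | yes _   | no _    | no _    = refl
    ... | no _    | yes _   | yes _   = refl
    ... | no _    | no a≮y  | yes a<x = contradiction (<-≤-trans a<x x≤y) a≮y
    ... | no x≰a  | _       | no a≮x  = contradiction (≮⇒≥ a≮x) x≰a

  count-below-all : count F (below n) ≡ ∣ F ∣
  count-below-all =
    trans (count-cong F λ k → trans (isYes≗does (toℕ k <? n)) (dec-true (toℕ k <? n) (toℕ<n k)))
          (count-true F)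

  count-below-mono : ∀ {x y} → x ≤ y → count F (below x) ≤ count F (below y)
  count-below-mono x≤y = subst (_ ≤_) (count-below-split x≤y) (m≤n+m _ _)

  count-between-suc : ∀ m → count F (between m (suc m)) ≤ 1
  count-between-suc m =
    count-≤1 F (between m (suc m)) λ k l k∈ l∈ →
      toℕ-injective (trans (at-m k k∈) (sym (at-m l l∈)))
    where
    at-m : ∀ k → between m (suc m) k ≡ true → toℕ k ≡ m
    at-m k k∈ with m ≤? toℕ k | toℕ k <? suc m | k∈
    ... | yes m≤k | yes k<1+m | _ = ≤-antisym (≤-pred k<1+m) m≤k
    ... | yes _   | no _      | ()
    ... | no _    | _         | ()

  count-below-suc : ∀ m → count F (below (suc m)) ≤ suc (count F (below m))
  count-below-suc m = subst (_≤ suc (count F (below m))) (count-below-split (n≤1+n m))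
                        (+-monoˡ-≤ (count F (below m)) (count-between-suc m))

module _ {n : ℕ} where
  private
    N = suc n

  offset-≥ : ∀ (i k : Fin N) → toℕ i ≤ toℕ k → offset i k + toℕ i ≡ toℕ k
  offset-≥ i k x≤a = begin
    (a + N ∸ x) % N + x  ≡⟨ cong (λ m → m % N + x) (+-∸-comm N x≤a) ⟩
    (a ∸ x + N) % N + x  ≡⟨ cong (_+ x) ([m+n]%n≡m%n (a ∸ x) N) ⟩
    (a ∸ x) % N + x      ≡⟨ cong (_+ x) (m<n⇒m%n≡m (≤-<-trans (m∸n≤m a x) (toℕ<n k))) ⟩
    a ∸ x + x            ≡⟨ m∸n+n≡m x≤a ⟩
    a                    ∎
    where
    open ≡-Reasoning
    x = toℕ i; a = toℕ k

  offset-< : ∀ (i k : Fin N) → toℕ k < toℕ i → offset i k + toℕ i ≡ toℕ k + N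
  offset-< i k a<x = begin
    (a + N ∸ x) % N + x  ≡⟨ cong (_+ x) (m<n⇒m%n≡m a+N∸x<N) ⟩
    a + N ∸ x + x        ≡⟨ m∸n+n≡m x≤a+N ⟩
    a + N                ∎
    where
    open ≡-Reasoning
    x = toℕ i; a = toℕ k
    x≤a+N = ≤-trans (<⇒≤ (toℕ<n i)) (m≤n+m N a)
    a+N∸x<N : a + N ∸ x < N
    a+N∸x<N = subst (a + N ∸ x <_) (m+n∸m≡n x N) (∸-monoˡ-< (+-monoˡ-< N a<x) x≤a+N)

  shift-< : ∀ {u v u′ v′} c → u + c ≡ u′ → v + c ≡ v′ → u < v ⇔ u′ < v′
  shift-< c refl refl = mk⇔ (+-monoˡ-< c) (+-cancelʳ-< c _ _)

  arc-forward : ∀ (i j k : Fin N) → toℕ i ≤ toℕ j →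
                ⌊ offset i k <? offset i j ⌋ ≡ between (toℕ i) (toℕ j) k
  arc-forward i j k x≤y = ⌊⌋-⇔ (mk⇔ to from) (offset i k <? offset i j) ((x ≤? a) ×-dec (a <? y))
    where
    x = toℕ i; y = toℕ j; a = toℕ k
    j-shift = offset-≥ i j x≤y
    to : offset i k < offset i j → x ≤ a × a < y
    to lt with x ≤? a
    ... | yes x≤a = x≤a , Equivalence.to (shift-< x (offset-≥ i k x≤a) j-shift) lt
    ... | no x≰a  = contradiction (Equivalence.to (shift-< x (offset-< i k (≰⇒> x≰a)) j-shift) lt)
                                  (≤⇒≯ (≤-trans (<⇒≤ (toℕ<n j)) (m≤n+m N a)))
    from : x ≤ a × a < y → offset i k < offset i j
    from (x≤a , a<y) = Equivalence.from (shift-< x (offset-≥ i k x≤a) j-shift) a<y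

  arc-backward : ∀ (i j k : Fin N) → toℕ i < toℕ j →
                 ⌊ offset j k <? offset j i ⌋ ≡ not (between (toℕ i) (toℕ j) k)
  arc-backward i j k x<y =
    trans (⌊⌋-⇔ (mk⇔ to from) (offset j k <? offset j i) (¬? ((x ≤? a) ×-dec (a <? y))))
          (⌊¬?⌋ _)
    where
    x = toℕ i; y = toℕ j; a = toℕ k
    i-shift = offset-< j i x<y
    to : offset j k < offset j i → ¬ (x ≤ a × a < y)
    to lt (x≤a , a<y) =
      <⇒≱ (+-cancelʳ-< N a x (Equivalence.to (shift-< y (offset-< j k a<y) i-shift) lt)) x≤a
    from : ¬ (x ≤ a × a < y) → offset j k < offset j i
    from ¬x≤a<y with a <? y
    ... | yes a<y = Equivalence.from (shift-< y (offset-< j k a<y) i-shift)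
                      (+-monoˡ-< N (≰⇒> λ x≤a → ¬x≤a<y (x≤a , a<y)))
    ... | no a≮y  = Equivalence.from (shift-< y (offset-≥ j k (≮⇒≥ a≮y)) i-shift)
                      (<-≤-trans (toℕ<n k) (m≤n+m N x))

  dist-between : ∀ (F : Subset N) (i j : Fin N) {x y} → toℕ i ≡ x → toℕ j ≡ y → x < y →
                 dist F i j ≡ count F (between x y) ⊓ count F (not ∘ between x y)
  dist-between F i j refl refl x<y =
    cong₂ _⊓_ (count-cong F λ k → arc-forward i j k (<⇒≤ x<y))
              (count-cong F λ k → arc-backward i j k x<y)

three-times : ∀ e → 3 * e ≡ e + (e + e)
three-times e = cong (λ v → e + (e + v)) (+-identityʳ e)

threshold-crossing : ∀ (g : ℕ → ℕ) {u} N → g 0 < u → u ≤ g N →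
                     ∃ λ p → p < N × g p < u × u ≤ g (suc p)
threshold-crossing g zero        g0<u u≤gN  = contradiction u≤gN (<⇒≱ g0<u)
threshold-crossing g {u} (suc N) g0<u u≤g1+N with u ≤? g N
... | no u≰gN  = N , ≤-refl , ≰⇒> u≰gN , u≤g1+N
... | yes u≤gN with threshold-crossing g N g0<u u≤gN
...   | p , p<N , gp<u , u≤g1+p = p , m≤n⇒m≤1+n p<N , gp<u , u≤g1+p

bracket-by-thirds : ∀ {f} → 0 < f → ∃ λ e → 3 * e < f × f ≤ 3 * suc e
bracket-by-thirds {suc g} _ = g / 3 , s≤s (subst (_≤ g) (*-comm (g / 3) 3) (m/n*n≤m g 3)) , g<3*[1+g/3]
  where
  open ≤-Reasoning
  g<3*[1+g/3] : g < 3 * suc (g / 3)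
  g<3*[1+g/3] = begin-strict
    g                      ≡⟨ m≡m%n+[m/n]*n g 3 ⟩
    g % 3 + g / 3 * 3      <⟨ +-monoˡ-< (g / 3 * 3) (m%n<n g 3) ⟩
    3 + g / 3 * 3          ≡⟨ cong (3 +_) (*-comm (g / 3) 3) ⟩
    3 + 3 * (g / 3)        ≡⟨ *-suc 3 (g / 3) ⟨
    3 * suc (g / 3)        ∎

pigeonhole-third : ∀ {a b c e} → 3 * e < a + b + c → e < a ⊎ e < b ⊎ e < c
pigeonhole-third {a} {b} {c} {e} 3e<a+b+c with e <? a | e <? b | e <? c
... | yes e<a | _       | _       = inj₁ e<a
... | no _    | yes e<b | _       = inj₂ (inj₁ e<b)
... | no _    | no _    | yes e<c = inj₂ (inj₂ e<c)
... | no e≮a  | no e≮b  | no e≮c  = contradiction 3e<a+b+c (≤⇒≯ a+b+c≤3e)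
  where
  a+b+c≤3e : a + b + c ≤ 3 * e
  a+b+c≤3e = subst (a + b + c ≤_) (trans (+-assoc e e e) (sym (three-times e)))
               (+-mono-≤ (+-mono-≤ (≮⇒≥ e≮a) (≮⇒≥ e≮b)) (≮⇒≥ e≮c))

arc-sums : ∀ {X Y Z a b c e} → X ≤ e → e < Y → Y ≤ e + e → e + e < Z →
           3 * e < a + b + c → Z ≤ a + b + c → a + X ≡ Y → b + Y ≡ Z →
           e < a + b × e < a + c × e < b + c
arc-sums {X} {Y} {Z} {a} {b} {c} {e} X≤e e<Y Y≤2e 2e<Z 3e<f Z≤f a+X≡Y b+Y≡Z =
  e<a+b , e<a+c , e<b+c
  where
  open ≤-Reasoning
  e<a+b : e < a + b
  e<a+b = +-cancelʳ-< e e (a + b) (begin-strict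
    e + e          <⟨ 2e<Z ⟩
    Z              ≡⟨ b+Y≡Z ⟨
    b + Y          ≡⟨ cong (b +_) a+X≡Y ⟨
    b + (a + X)    ≡⟨ x∙yz≈yx∙z b a X ⟩
    a + b + X      ≤⟨ +-monoʳ-≤ (a + b) X≤e ⟩
    a + b + e      ∎)
  e<a+c : e < a + c
  e<a+c = <-≤-trans e<Y (+-cancelˡ-≤ b Y (a + c) (begin
    b + Y          ≡⟨ b+Y≡Z ⟩
    Z              ≤⟨ Z≤f ⟩
    a + b + c      ≡⟨ xy∙z≈y∙xz a b c ⟩
    b + (a + c)    ∎))
  e<b+c : e < b + c
  e<b+c = +-cancelˡ-< (e + e) e (b + c) (begin-strict
    e + e + e        ≡⟨ +-assoc e e e ⟩
    e + (e + e)      ≡⟨ three-times e ⟨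
    3 * e            <⟨ 3e<f ⟩
    a + b + c        ≡⟨ +-assoc a b c ⟩
    a + (b + c)      ≤⟨ +-monoˡ-≤ (b + c) (≤-trans (subst (a ≤_) a+X≡Y (m≤m+n a X)) Y≤2e) ⟩
    e + e + (b + c)  ∎)

module CycleBags {G : Graph} {n : ℕ} (vtx : Fin (suc n) → Graph.V G)
                 (adj : ∀ i → Graph.Adj G (vtx i) (vtx (csuc i)))
                 (D : TreeDecomposition G) (F : Subset (suc n)) where
  open TreeDecomposition D
  open TreePaths T isTree using (median)

  N : ℕ
  N = suc n

  -- Iterating csuc rather than reducing modulo N makes walk a closed walk along C
  -- whose consecutive vertices are adjacent by adj itself.
  position : ℕ → Fin N
  position zero    = fzero
  position (suc k) = csuc (position k)

  walk : ℕ → Graph.V G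
  walk = vtx ∘ position

  toℕ-position : ∀ {k} → k < N → toℕ (position k) ≡ k
  toℕ-position {zero}  _     = refl
  toℕ-position {suc k} 1+k<N = begin
    toℕ (csuc (position k))      ≡⟨ toℕ-fromℕ< _ ⟩
    suc (toℕ (position k)) % N   ≡⟨ cong (λ v → suc v % N) (toℕ-position (<-trans (n<1+n k) 1+k<N)) ⟩
    suc k % N                    ≡⟨ m<n⇒m%n≡m 1+k<N ⟩
    suc k                        ∎
    where open ≡-Reasoning

  position-N : position N ≡ fzero
  position-N = toℕ-injective (begin
    toℕ (csuc (position n))      ≡⟨ toℕ-fromℕ< _ ⟩
    suc (toℕ (position n)) % N   ≡⟨ cong (λ v → suc v % N) (toℕ-position (n<1+n n)) ⟩
    N % N                        ≡⟨ n%n≡0 N ⟩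
    0                            ∎)
    where open ≡-Reasoning

  f : ℕ
  f = ∣ F ∣

  prefix : ℕ → ℕ
  prefix m = count F (below m)

  FarPairInBag : Set
  FarPairInBag = ∃ λ (t : Graph.V T) → Σ (Fin N) λ i → Σ (Fin N) λ j →
                   B t (vtx i) × B t (vtx j) × f ≤ 3 * dist F i j

  far-pair : ∀ {t x y} e → x < y → y < N → B t (walk x) → B t (walk y) → f ≤ 3 * suc e →
             e < count F (between x y) → e < count F (not ∘ between x y) → FarPairInBag
  far-pair {t} {x} {y} e x<y y<N Bx By f≤3[1+e] e<inner e<outer =
    t , position x , position y , Bx , By ,
    ≤-trans f≤3[1+e] (*-monoʳ-≤ 3 (subst (suc e ≤_) (sym dist≡) (⊓-glb e<inner e<outer)))
    where
    dist≡ = dist-between F (position x) (position y)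
              (toℕ-position (<-trans x<y y<N)) (toℕ-position y<N) x<y

  edge-bag : ∀ k → ∃ λ t → B t (walk k) × B t (walk (suc k))
  edge-bag k = edge (walk k) (walk (suc k)) (adj (position k))

  bag-meets-segment : ∀ {lo hi a b r} → lo ≤ hi → B a (walk lo) → B b (walk hi) → OnPath T a r b →
                      ∃ λ k → lo ≤ k × k ≤ hi × B r (walk k)
  bag-meets-segment lo≤hi = walk-meets-path-bags D walk (adj ∘ position) (≤⇒≤′ lo≤hi)

  prefix-0<1+ : ∀ u → prefix 0 < suc u
  prefix-0<1+ u = subst (_< suc u) (sym (count-false F)) (s≤s z≤n)

  f≤1+prefix-n : f ≤ suc (prefix n)
  f≤1+prefix-n = subst (_≤ suc (prefix n)) (count-below-all F) (count-below-suc F n)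

  few-edges : 2 ≤ f → f ≤ 3 → FarPairInBag
  few-edges 2≤f f≤3
    with threshold-crossing prefix n (prefix-0<1+ 0) (≤-pred (≤-trans 2≤f f≤1+prefix-n))
  ... | p , p<n , Pp<1 , 1≤P1+p with edge-bag p
  ...   | t , Bp , B1+p = far-pair 0 (n<1+n p) (s≤s p<n) Bp B1+p f≤3 0<a 0<b
    where
    a = count F (between p (suc p))
    b = count F (not ∘ between p (suc p))
    0<a : 0 < a
    0<a = subst (1 ≤_) (begin-equality
      prefix (suc p)   ≡⟨ count-below-split F (n≤1+n p) ⟨
      a + prefix p     ≡⟨ cong (a +_) (n<1⇒n≡0 Pp<1) ⟩
      a + 0            ≡⟨ +-identityʳ a ⟩
      a                ∎) 1≤P1+p
      where open ≤-Reasoning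
    0<b : 0 < b
    0<b = +-cancelˡ-≤ 1 1 b (≤-trans 2≤f
            (subst (_≤ 1 + b) (count-not F (between p (suc p))) (+-monoˡ-≤ b (count-between-suc F p))))

  three-points : ∀ {t x y z} e → x < y → y < z → z < N → B t (walk x) → B t (walk y) → B t (walk z) →
                 3 * e < f → f ≤ 3 * suc e →
                 prefix x ≤ e → e < prefix y → prefix y ≤ e + e → e + e < prefix z → FarPairInBag
  three-points {x = x} {y} {z} e x<y y<z z<N Bx By Bz 3e<f f≤3[1+e] X≤e e<Y Y≤2e 2e<Z =
    choose (pigeonhole-third (subst (3 * e <_) (sym a+b+c≡f) 3e<f))
    where
    a = count F (between x y)
    b = count F (between y z)
    c = count F (not ∘ between x z)
    a+X≡Y = count-below-split F (<⇒≤ x<y)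
    b+Y≡Z = count-below-split F (<⇒≤ y<z)
    xz≡a+b : count F (between x z) ≡ a + b
    xz≡a+b = +-cancelʳ-≡ (prefix x) _ _ (begin
      count F (between x z) + prefix x   ≡⟨ count-below-split F (<⇒≤ (<-trans x<y y<z)) ⟩
      prefix z                           ≡⟨ b+Y≡Z ⟨
      b + prefix y                       ≡⟨ cong (b +_) a+X≡Y ⟨
      b + (a + prefix x)                 ≡⟨ x∙yz≈yx∙z b a (prefix x) ⟩
      a + b + prefix x                   ∎)
      where open ≡-Reasoning
    a+b+c≡f : a + b + c ≡ f
    a+b+c≡f = trans (cong (_+ c) (sym xz≡a+b)) (count-not F (between x z))
    outside-xy : count F (not ∘ between x y) ≡ b + c
    outside-xy = count-not-≡ F (between x y) (trans (sym (+-assoc a b c)) a+b+c≡f)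
    outside-yz : count F (not ∘ between y z) ≡ a + c
    outside-yz = count-not-≡ F (between y z) (trans (x∙yz≈yx∙z b a c) a+b+c≡f)
    sums = arc-sums X≤e e<Y Y≤2e 2e<Z (subst (3 * e <_) (sym a+b+c≡f) 3e<f)
             (subst (prefix z ≤_) (sym a+b+c≡f) (count≤∣F∣ F (below z))) a+X≡Y b+Y≡Z
    e<a+b = proj₁ sums
    e<a+c = proj₁ (proj₂ sums)
    e<b+c = proj₂ (proj₂ sums)
    choose : e < a ⊎ e < b ⊎ e < c → FarPairInBag
    choose (inj₁ e<a) = far-pair e x<y (<-trans y<z z<N) Bx By f≤3[1+e]
      e<a (subst (e <_) (sym outside-xy) e<b+c)
    choose (inj₂ (inj₁ e<b)) = far-pair e y<z z<N By Bz f≤3[1+e]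
      e<b (subst (e <_) (sym outside-yz) e<a+c)
    choose (inj₂ (inj₂ e<c)) = far-pair e (<-trans x<y y<z) z<N Bx Bz f≤3[1+e]
      (subst (e <_) (sym xz≡a+b) e<a+b) e<c

  median-of-edge-bags : ∀ e {p s} → p < s → s < n → 3 * e < f → f ≤ 3 * suc e →
                        prefix p ≤ e → e < prefix (suc p) → prefix s ≤ e + e → e + e < prefix (suc s) →
                        FarPairInBag
  median-of-edge-bags e {p} {s} p<s s<n 3e<f f≤3[1+e] Pp≤e e<P1+p Ps≤2e 2e<P1+s
    with edge-bag p | edge-bag s | edge-bag n
  ... | t₁ , B₁p , B₁1+p | t₂ , B₂s , B₂1+s | t₃ , B₃n , B₃N
    with median t₃ t₁ t₂
  ... | m , o₃₁ , o₁₂ , o₂₃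
    with bag-meets-segment z≤n (subst (B t₃ ∘ vtx) position-N B₃N) B₁p o₃₁
       | bag-meets-segment p<s B₁1+p B₂s o₁₂
       | bag-meets-segment s<n B₂1+s B₃n o₂₃
  ... | x , _ , x≤p , Bx | y , 1+p≤y , y≤s , By | z , 1+s≤z , z≤n′ , Bz =
    three-points e (≤-<-trans x≤p 1+p≤y) (≤-<-trans y≤s 1+s≤z) (s≤s z≤n′) Bx By Bz 3e<f f≤3[1+e]
      (≤-trans (count-below-mono F x≤p) Pp≤e)
      (<-≤-trans e<P1+p (count-below-mono F 1+p≤y))
      (≤-trans (count-below-mono F y≤s) Ps≤2e)
      (<-≤-trans 2e<P1+s (count-below-mono F 1+s≤z))

  many-edges : 4 ≤ f → FarPairInBag
  many-edges 4≤f with bracket-by-thirds (≤-trans (s≤s z≤n) 4≤f)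
  ... | e , 3e<f , f≤3[1+e] = crossings
    where
    1≤e : 1 ≤ e
    1≤e = ≰⇒> λ e≤0 →
      contradiction (≤-trans 4≤f (subst (λ v → f ≤ 3 * suc v) (n≤0⇒n≡0 e≤0) f≤3[1+e])) (<-irrefl refl)
    1+e≤f : suc e ≤ f
    1+e≤f = ≤-<-trans (m≤m+n e _) 3e<f
    2+2e≤f : suc (suc (e + e)) ≤ f
    2+2e≤f = ≤-trans (s≤s (+-monoˡ-≤ (e + e) 1≤e)) (subst (_< f) (three-times e) 3e<f)
    crossings : FarPairInBag
    crossings
      with threshold-crossing prefix N (prefix-0<1+ e) (subst (suc e ≤_) (sym (count-below-all F)) 1+e≤f)
         | threshold-crossing prefix n (prefix-0<1+ (e + e)) (≤-pred (≤-trans 2+2e≤f f≤1+prefix-n))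
    ... | p , _ , Pp<1+e , 1+e≤P1+p | s , s<n , Ps<1+2e , 1+2e≤P1+s =
      median-of-edge-bags e p<s s<n 3e<f f≤3[1+e] (≤-pred Pp<1+e) 1+e≤P1+p (≤-pred Ps<1+2e) 1+2e≤P1+s
      where
      p<s : p < s
      p<s = ≰⇒> λ s≤p → <⇒≱ 1+2e≤P1+s (begin
        prefix (suc s)   ≤⟨ count-below-mono F (s≤s s≤p) ⟩
        prefix (suc p)   ≤⟨ count-below-suc F p ⟩
        suc (prefix p)   ≤⟨ Pp<1+e ⟩
        suc e            ≤⟨ +-monoˡ-≤ e 1≤e ⟩
        e + e            ∎)
        where open ≤-Reasoning

  far-pair-in-bag : 2 ≤ f → FarPairInBag
  far-pair-in-bag 2≤f with f ≤? 3
  ... | yes f≤3 = few-edges 2≤f f≤3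
  ... | no  f≰3 = many-edges (≰⇒> f≰3)

lemma2p3 : (G : Graph) (C : Cycle G) (F : Subset (Cycle.len C)) →
    2 ≤ ∣ F ∣ → (D : TreeDecomposition G) →
    ∃ λ (t : Graph.V (TreeDecomposition.T D)) →
    Σ (Fin (Cycle.len C)) λ i → Σ (Fin (Cycle.len C)) λ j →
      TreeDecomposition.B D t (Cycle.vtx C i) × TreeDecomposition.B D t (Cycle.vtx C j) ×
      ∣ F ∣ ≤ 3 * dist F i j
lemma2p3 G record { len = zero ; len≥3 = () } F 2≤f D
lemma2p3 G record { len = suc n ; vtx = vtx ; adj = adj } F 2≤f D =
  CycleBags.far-pair-in-bag vtx adj D F 2≤f
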